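{- Let $\alpha$ be a tautology of minimal implicational logic $\mathbf{M}^{\rightarrow}$. Then there is a cut-free proof of the sequent $\Rightarrow \alpha$ in the sequent calculus $\mathbf{LJ}^{\rightarrow}$ whose height is at most $|\alpha| \cdot 2^{|\alpha|+1}$. (Thus the size of proofs of implicational tautologies in $\mathbf{LJ}^{\rightarrow}$ obeys the same bound as for normal Natural Deduction proofs.)
   Context: Formulas of $\mathbf{M}^{\rightarrow}$ are built from a countable set of atoms using only the binary connective $\rightarrow$ (omitted parentheses associate to the right). Kripke semantics: a model is $\langle U,\preceq,\mathcal{V}\rangle$ with $U$ nonempty, $\preceq$ a partial order on $U$, and $\mathcal{V}$ assigning to each world a set of atoms such that $i\preceq j$ implies $\mathcal{V}(i)\subseteq\mathcal{V}(j)$; $i\models p$ iff $p\in\mathcal{V}(i)$, and $i\models\alpha\rightarrow\beta$ iff for every $j\succeq i$, $j\models\alpha$ implies $j\models\beta$. A tautology is a formula true at every world of every model. $|\alpha|$ denotes the degree of $\alpha$, i.e. the number of occurrences of atomic symbols and connectives in $\alpha$. The calculus $\mathbf{LJ}^{\rightarrow}$ has sequents $\Delta\Rightarrow\gamma$ ($\Delta$ a multiset of formulas, exactly one formula on the right) and rules: axiom $\Delta,\gamma\Rightarrow\gamma$; weakening, contraction and exchange on the left; cut (from $\Delta\Rightarrow\alpha$ and $\alpha,\Gamma\Rightarrow\gamma$ infer $\Delta,\Gamma\Rightarrow\gamma$); $\rightarrow$-right (from $\Delta,\alpha\Rightarrow\beta$ infer $\Delta\Rightarrow\alpha\rightarrow\beta$);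 $\rightarrow$-left (from $\Delta,\alpha\rightarrow\beta\Rightarrow\alpha$ and $\Delta,\alpha\rightarrow\beta,\beta\Rightarrow\gamma$ infer $\Delta,\alpha\rightarrow\beta\Rightarrow\gamma$). Cut-free means the cut rule is not used. -}

module Defs where

open import Data.Nat using (ℕ; _+_; _*_; _^_; _⊔_; _≤_)
import Data.Nat as N
open import Data.List using (List; []; _∷_; _++_)
open import Data.List.Relation.Binary.Permutation.Propositional using (_↭_)
open import Relation.Binary.Structures using (IsPartialOrder)
open import Relation.Binary.PropositionalEquality using (_≡_)

infixr 5 _⇒_
data Formula : Set where
  atom : ℕ → Formula
  _⇒_  : Formula → Formula → Formula

degree : Formula → ℕ
degree (atom p) = 1
degree (α ⇒ β) = N.suc (degree α + degree β)

record KripkeModel : Set₁ where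
  field
    World   : Set
    inhabit : World
    _≼_     : World → World → Set
    isPO    : IsPartialOrder _≡_ _≼_
    V       : World → ℕ → Set
    mono    : ∀ {i j} → i ≼ j → ∀ p → V i p → V j p

open KripkeModel public

_,_⊩_ : (M : KripkeModel) → World M → Formula → Set
M , i ⊩ atom p  = V M i p
M , i ⊩ (α ⇒ β) = ∀ j → _≼_ M i j → M , j ⊩ α → M , j ⊩ β

Tautology : Formula → Set₁
Tautology α = ∀ (M : KripkeModel) (i : World M) → M , i ⊩ α

-- The sequent calculus LJ→ ; contexts are multisets, represented as lists
-- with an explicit exchange rule (permutation).
infix 4 _⊢_
data _⊢_ : List Formula → Formula → Set where
  ax    : ∀ {Δ γ} → (γ ∷ Δ) ⊢ γ
  weak  : ∀ {Δ α γ} → Δ ⊢ γ → (α ∷ Δ) ⊢ γ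
  contr : ∀ {Δ α γ} → (α ∷ α ∷ Δ) ⊢ γ → (α ∷ Δ) ⊢ γ
  exch  : ∀ {Δ Δ′ γ} → Δ ↭ Δ′ → Δ ⊢ γ → Δ′ ⊢ γ
  cut   : ∀ {Δ Γ α γ} → Δ ⊢ α → (α ∷ Γ) ⊢ γ → (Δ ++ Γ) ⊢ γ
  ⇒R    : ∀ {Δ α β} → (α ∷ Δ) ⊢ β → Δ ⊢ (α ⇒ β)
  ⇒L    : ∀ {Δ α β γ} → ((α ⇒ β) ∷ Δ) ⊢ α → (β ∷ (α ⇒ β) ∷ Δ) ⊢ γ
        → ((α ⇒ β) ∷ Δ) ⊢ γ

height : ∀ {Δ γ} → Δ ⊢ γ → ℕ
height ax          = 0
height (weak d)    = N.suc (height d)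
height (contr d)   = N.suc (height d)
height (exch _ d)  = N.suc (height d)
height (cut d e)   = N.suc (height d ⊔ height e)
height (⇒R d)      = N.suc (height d)
height (⇒L d e)    = N.suc (height d ⊔ height e)

data CutFree : ∀ {Δ γ} → Δ ⊢ γ → Set where
  ax    : ∀ {Δ γ} → CutFree (ax {Δ} {γ})
  weak  : ∀ {Δ α γ} {d : Δ ⊢ γ} → CutFree d → CutFree (weak {α = α} d)
  contr : ∀ {Δ α γ} {d : (α ∷ α ∷ Δ) ⊢ γ} → CutFree d → CutFree (contr d)
  exch  : ∀ {Δ Δ′ γ} {π : Δ ↭ Δ′} {d : Δ ⊢ γ} → CutFree d → CutFree (exch π d)
  ⇒R    : ∀ {Δ α β} {d : (α ∷ Δ) ⊢ β} → CutFree d → CutFree (⇒R d)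
  ⇒L    : ∀ {Δ α β γ} {d : ((α ⇒ β) ∷ Δ) ⊢ α} {e : (β ∷ (α ⇒ β) ∷ Δ) ⊢ γ}
        → CutFree d → CutFree e → CutFree (⇒L d e)

-- Completeness by countermodel construction, with the derivations read off the construction.
-- For every context Γ of antecedents of α we build a Kripke model whose root forces Γ and
-- which separates the subformulas of α: each is either derivable from Γ by a short cut-free
-- derivation or not forced at the root. This is by induction on the number of antecedents
-- missing from Γ. Given separators for all one-antecedent extensions c ∷ Γ, saturate Γ in
-- stages: an atom becomes reachable once some assumption in Γ with that target has all its
-- premises reachable, and an implication c ⇒ d with c ∉ Γ is settled by the separator for
-- c ∷ Γ. The stages stabilise after as many rounds as α has atom occurrences; the model for Γ
-- is a new root, forcing exactly the reachable atoms, placed below all the separators for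
-- the extensions. A round adds O(|α|) to the height, a level O(|α|²), and there are at most
-- |α| levels; this cubic bound is below |α|·2^(|α|+1). For Γ = [] a tautology cannot be refuted.
module Submission where

open import Defs
open import Data.Nat using (ℕ; zero; suc; _*_; _+_; _^_; _≤_; _<_; _⊔_; z≤n; s≤s)
import Data.Nat as ℕ
open import Data.Nat.Properties hiding (_≟_)
open import Data.Nat.Tactic.RingSolver using (solve-∀)
open import Data.List using (List; []; _∷_; _++_; _∷ʳ_; [_]; length)
open import Data.List.Properties using (++-assoc; ++-identityʳ; length-++)
open import Data.List.Relation.Unary.All as All using (All; []; _∷_)
open import Data.List.Relation.Unary.All.Properties using (++⁻; ∷ʳ⁺)
open import Data.List.Relation.Unary.Any as Any using (Any; here; there)
open import Data.List.Membership.Propositional using (_∈_; _∉_; lose)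
open import Data.List.Membership.Propositional.Properties using (∈-∃++; ∈-++⁺ˡ; ∈-++⁺ʳ; ∈-++⁻)
open import Data.List.Relation.Binary.Permutation.Propositional as ↭ using (_↭_; ↭-sym; prep)
open import Data.List.Relation.Binary.Permutation.Propositional.Properties using (All-resp-↭; ++⁺ʳ; shift; ++-comm)
open import Data.Product as Product using (Σ; _×_; _,_; proj₁)
open import Data.Sum using (_⊎_; inj₁; inj₂)
open import Data.Empty using (⊥-elim)
open import Function using (_∘_)
open import Relation.Nullary using (¬_; Dec; yes; no; _×-dec_; _⊎-dec_)
import Relation.Nullary.Decidable as Dec
open import Relation.Binary.Definitions using (DecidableEquality)
open import Relation.Binary.PropositionalEquality hiding ([_])
open import Relation.Binary.Structures using (IsPartialOrder)

infix 4 _≟_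
_≟_ : DecidableEquality Formula
atom p ≟ atom q with p ℕ.≟ q
... | yes refl = yes refl
... | no p≢q   = no λ { refl → p≢q refl }
atom _ ≟ (_ ⇒ _) = no λ ()
(_ ⇒ _) ≟ atom _ = no λ ()
(a ⇒ b) ≟ (c ⇒ d) with a ≟ c | b ≟ d
... | yes refl | yes refl = yes refl
... | no a≢c   | _        = no λ { refl → a≢c refl }
... | yes _    | no b≢d   = no λ { refl → b≢d refl }

open import Data.List.Membership.DecPropositional _≟_ using (_∈?_)

infix 4 _⊑_
data _⊑_ : Formula → Formula → Set where
  here : ∀ {x} → x ⊑ x
  ⇒ˡ   : ∀ {x a b} → x ⊑ a → x ⊑ a ⇒ b
  ⇒ʳ   : ∀ {x a b} → x ⊑ b → x ⊑ a ⇒ b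

⊑-trans : ∀ {x y z} → x ⊑ y → y ⊑ z → x ⊑ z
⊑-trans x⊑y here     = x⊑y
⊑-trans x⊑y (⇒ˡ y⊑z) = ⇒ˡ (⊑-trans x⊑y y⊑z)
⊑-trans x⊑y (⇒ʳ y⊑z) = ⇒ʳ (⊑-trans x⊑y y⊑z)

⇒-⊑ˡ : ∀ {a b z} → a ⇒ b ⊑ z → a ⊑ z
⇒-⊑ˡ = ⊑-trans (⇒ˡ here)

⇒-⊑ʳ : ∀ {a b z} → a ⇒ b ⊑ z → b ⊑ z
⇒-⊑ʳ = ⊑-trans (⇒ʳ here)

connectives : Formula → ℕ
connectives (atom _) = 0
connectives (a ⇒ b) = suc (connectives a + connectives b)

antecedents : Formula → List Formula
antecedents (atom _) = []
antecedents (a ⇒ b) = a ∷ antecedents a ++ antecedents b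

atoms : Formula → List ℕ
atoms (atom p) = [ p ]
atoms (a ⇒ b) = atoms a ++ atoms b

premises : Formula → List Formula
premises (atom _) = []
premises (a ⇒ b) = a ∷ premises b

target : Formula → ℕ
target (atom p) = p
target (a ⇒ b) = target b

infixr 5 _⟶_
_⟶_ : List Formula → Formula → Formula
[] ⟶ y = y
(c ∷ cs) ⟶ y = c ⇒ (cs ⟶ y)

premises⟶target : ∀ x → premises x ⟶ atom (target x) ≡ x
premises⟶target (atom p) = refl
premises⟶target (a ⇒ b) = cong (a ⇒_) (premises⟶target b)

premises-⟶ : ∀ cs p → premises (cs ⟶ atom p) ≡ cs
premises-⟶ [] p = refl
premises-⟶ (c ∷ cs) p = cong (c ∷_) (premises-⟶ cs p)

target-⟶ : ∀ cs p → target (cs ⟶ atom p) ≡ p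
target-⟶ [] p = refl
target-⟶ (c ∷ cs) p = target-⟶ cs p

⟶-∷ʳ : ∀ cs c d → cs ⟶ (c ⇒ d) ≡ (cs ∷ʳ c) ⟶ d
⟶-∷ʳ [] c d = refl
⟶-∷ʳ (x ∷ cs) c d = cong (x ⇒_) (⟶-∷ʳ cs c d)

length-antecedents : ∀ α → length (antecedents α) ≡ connectives α
length-antecedents (atom _) = refl
length-antecedents (a ⇒ b) = cong suc (begin
  length (antecedents a ++ antecedents b)           ≡⟨ length-++ (antecedents a) ⟩
  length (antecedents a) + length (antecedents b)   ≡⟨ cong₂ _+_ (length-antecedents a) (length-antecedents b) ⟩
  connectives a + connectives b                     ∎)
  where open ≡-Reasoning

length-atoms : ∀ α → length (atoms α) ≡ suc (connectives α)
length-atoms (atom _) = refl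
length-atoms (a ⇒ b) = begin
  length (atoms a ++ atoms b)                   ≡⟨ length-++ (atoms a) ⟩
  length (atoms a) + length (atoms b)           ≡⟨ cong₂ _+_ (length-atoms a) (length-atoms b) ⟩
  suc (connectives a) + suc (connectives b)     ≡⟨ cong suc (+-suc (connectives a) (connectives b)) ⟩
  suc (suc (connectives a + connectives b))     ∎
  where open ≡-Reasoning

antecedent∈ : ∀ {c d α} → c ⇒ d ⊑ α → c ∈ antecedents α
antecedent∈ here = here refl
antecedent∈ (⇒ˡ s) = there (∈-++⁺ˡ (antecedent∈ s))
antecedent∈ {α = a ⇒ _} (⇒ʳ s) = there (∈-++⁺ʳ (antecedents a) (antecedent∈ s))

∈antecedents⇒⊑ : ∀ {c} α → c ∈ antecedents α → c ⊑ α
∈antecedents⇒⊑ (a ⇒ b) (here refl) = ⇒ˡ here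
∈antecedents⇒⊑ (a ⇒ b) (there c∈) with ∈-++⁻ (antecedents a) c∈
... | inj₁ c∈a = ⇒ˡ (∈antecedents⇒⊑ a c∈a)
... | inj₂ c∈b = ⇒ʳ (∈antecedents⇒⊑ b c∈b)

target∈atoms : ∀ {x} α → x ⊑ α → target x ∈ atoms α
target∈atoms {atom p} (atom q) here = here refl
target∈atoms {a ⇒ b} .(a ⇒ b) here = ∈-++⁺ʳ (atoms a) (target∈atoms b here)
target∈atoms (a ⇒ b) (⇒ˡ s) = ∈-++⁺ˡ (target∈atoms a s)
target∈atoms (a ⇒ b) (⇒ʳ s) = ∈-++⁺ʳ (atoms a) (target∈atoms b s)

connectives-mono-⊑ : ∀ {x α} → x ⊑ α → connectives x ≤ connectives α
connectives-mono-⊑ here = ≤-refl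
connectives-mono-⊑ {α = a ⇒ b} (⇒ˡ s) =
  ≤-trans (connectives-mono-⊑ s) (m≤n⇒m≤1+n (m≤m+n (connectives a) (connectives b)))
connectives-mono-⊑ {α = a ⇒ b} (⇒ʳ s) =
  ≤-trans (connectives-mono-⊑ s) (m≤n⇒m≤1+n (m≤n+m (connectives b) (connectives a)))

length-premises≤connectives : ∀ x → length (premises x) ≤ connectives x
length-premises≤connectives (atom _) = z≤n
length-premises≤connectives (a ⇒ b) =
  s≤s (≤-trans (length-premises≤connectives b) (m≤n+m (connectives b) (connectives a)))

length-premises≤-⊑ : ∀ {x α} → x ⊑ α → length (premises x) ≤ connectives α
length-premises≤-⊑ {x} s = ≤-trans (length-premises≤connectives x) (connectives-mono-⊑ s)

premises-⊑ : ∀ {x α} → x ⊑ α → All (_⊑ α) (premises x)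
premises-⊑ {atom _} s = []
premises-⊑ {a ⇒ b} s = ⇒-⊑ˡ s ∷ premises-⊑ (⇒-⊑ʳ s)

module _ (M : KripkeModel) where
  private
    module M = IsPartialOrder (isPO M)

  ⊩-mono : ∀ {i j} δ → _≼_ M i j → M , i ⊩ δ → M , j ⊩ δ
  ⊩-mono (atom p) i≼j i⊩p = mono M i≼j p i⊩p
  ⊩-mono (a ⇒ b) i≼j i⊩a⇒b k j≼k = i⊩a⇒b k (M.trans i≼j j≼k)

  soundness : ∀ {Δ γ} → Δ ⊢ γ → ∀ i → All (M , i ⊩_) Δ → M , i ⊩ γ
  soundness ax i (i⊩γ ∷ _) = i⊩γ
  soundness (weak d) i (_ ∷ i⊩Δ) = soundness d i i⊩Δ
  soundness (contr d) i (i⊩α ∷ i⊩Δ) = soundness d i (i⊩α ∷ i⊩α ∷ i⊩Δ)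
  soundness (exch π d) i i⊩Δ = soundness d i (All-resp-↭ (↭-sym π) i⊩Δ)
  soundness (cut {Δ = Δ} d e) i i⊩ΔΓ with ++⁻ Δ i⊩ΔΓ
  ... | i⊩Δ , i⊩Γ = soundness e i (soundness d i i⊩Δ ∷ i⊩Γ)
  soundness (⇒R d) i i⊩Δ j i≼j j⊩α = soundness d j (j⊩α ∷ All.map (λ {δ} → ⊩-mono δ i≼j) i⊩Δ)
  soundness (⇒L d e) i (i⊩α⇒β ∷ i⊩Δ) =
    soundness e i (i⊩α⇒β i M.refl (soundness d i (i⊩α⇒β ∷ i⊩Δ)) ∷ i⊩α⇒β ∷ i⊩Δ)

  ⊩-⟶-elim : ∀ j cs y → M , j ⊩ (cs ⟶ y) → All (M , j ⊩_) cs → M , j ⊩ y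
  ⊩-⟶-elim j [] y j⊩y [] = j⊩y
  ⊩-⟶-elim j (c ∷ cs) y j⊩c⇒cs⟶y (j⊩c ∷ j⊩cs) = ⊩-⟶-elim j cs y (j⊩c⇒cs⟶y j M.refl j⊩c) j⊩cs

Bounded : ℕ → List Formula → Formula → Set
Bounded h Γ δ = Σ (Γ ⊢ δ) λ d → CutFree d × height d ≤ h

Bounded-mono : ∀ {h h′ Γ δ} → h ≤ h′ → Bounded h Γ δ → Bounded h′ Γ δ
Bounded-mono h≤h′ (d , cf , d≤h) = d , cf , ≤-trans d≤h h≤h′

-- Weakening at the end of the context is admissible without the weakening rule, since it can
-- be pushed up to the axioms.
⊢-++ʳ : ∀ {Δ γ} E (d : Δ ⊢ γ) → CutFree d → Σ (Δ ++ E ⊢ γ) λ d′ → CutFree d′ × height d′ ≡ height d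
⊢-++ʳ E ax ax = ax , ax , refl
⊢-++ʳ E (weak d) (weak cf) with ⊢-++ʳ E d cf
... | d′ , cf′ , eq = weak d′ , weak cf′ , cong suc eq
⊢-++ʳ E (contr d) (contr cf) with ⊢-++ʳ E d cf
... | d′ , cf′ , eq = contr d′ , contr cf′ , cong suc eq
⊢-++ʳ E (exch π d) (exch cf) with ⊢-++ʳ E d cf
... | d′ , cf′ , eq = exch (++⁺ʳ E π) d′ , exch cf′ , cong suc eq
⊢-++ʳ E (⇒R d) (⇒R cf) with ⊢-++ʳ E d cf
... | d′ , cf′ , eq = ⇒R d′ , ⇒R cf′ , cong suc eq
⊢-++ʳ E (⇒L d e) (⇒L cfd cfe) with ⊢-++ʳ E d cfd | ⊢-++ʳ E e cfe
... | d′ , cfd′ , eqd | e′ , cfe′ , eqe = ⇒L d′ e′ , ⇒L cfd′ cfe′ , cong suc (cong₂ _⊔_ eqd eqe)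

Bounded-↭-++ : ∀ {h Γ Δ γ} E → Γ ++ E ↭ Δ → Bounded h Γ γ → Bounded (suc h) Δ γ
Bounded-↭-++ E π (d , cf , d≤h) with ⊢-++ʳ E d cf
... | d′ , cf′ , eq = exch π d′ , exch cf′ , s≤s (subst (_≤ _) (sym eq) d≤h)

-- One left rule per premise; the principal formulas already used are collected in E.
⇒L-spine : ∀ {Γ h} p cs Δ E → Γ ++ E ↭ (cs ⟶ atom p) ∷ Δ → All (Bounded h Γ) cs
         → Bounded (length cs + suc h) ((cs ⟶ atom p) ∷ Δ) (atom p)
⇒L-spine p [] Δ E π [] = ax , ax , z≤n
⇒L-spine {Γ} {h} p (c ∷ cs) Δ E π (⊢c ∷ ⊢cs)
  with Bounded-↭-++ E π ⊢c | ⇒L-spine p cs ((c ⇒ (cs ⟶ atom p)) ∷ Δ) (E ∷ʳ (cs ⟶ atom p)) π′ ⊢cs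
  where
    π′ : Γ ++ E ∷ʳ (cs ⟶ atom p) ↭ (cs ⟶ atom p) ∷ (c ⇒ (cs ⟶ atom p)) ∷ Δ
    π′ = ↭.trans (↭.↭-reflexive (sym (++-assoc Γ E _)))
                 (↭.trans (++-comm (Γ ++ E) [ cs ⟶ atom p ]) (prep _ π))
... | d , cfd , d≤ | e , cfe , e≤ =
  ⇒L d e , ⇒L cfd cfe , s≤s (⊔-lub (≤-trans d≤ (m≤n+m (suc h) (length cs))) e≤)

Bounded-target : ∀ {Γ h x} → x ∈ Γ → All (Bounded h Γ) (premises x)
               → Bounded (suc (length (premises x) + suc h)) Γ (atom (target x))
Bounded-target {x = x} x∈Γ ⊢premises with ∈-∃++ x∈Γ
... | ys , zs , refl =
  let d , cf , d≤ = ⇒L-spine (target x) (premises x) (ys ++ zs) []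
                      (↭.trans (↭.↭-reflexive (++-identityʳ _)) x-first) ⊢premises
  in exch (↭-sym x-first) d , exch cf , s≤s d≤
  where
    x-first : ys ++ [ x ] ++ zs ↭ (premises x ⟶ atom (target x)) ∷ ys ++ zs
    x-first = subst (λ z → ys ++ [ x ] ++ zs ↭ z ∷ ys ++ zs) (sym (premises⟶target x)) (shift x ys zs)

-- Stabilisation of a monotone sequence of decidable predicates on a finite list

module Stabilisation {X : Set} (A : ℕ → X → Set) (A? : ∀ t x → Dec (A t x))
  (A-suc : ∀ {t x} → A t x → A (suc t) x) (xs : List X)
  (settled-suc : ∀ t → All (λ x → A (suc t) x → A t x) xs
                     → All (λ x → A (suc (suc t)) x → A (suc t) x) xs)
  where

  Settled : ℕ → List X → Set
  Settled t ys = All (λ y → A (suc t) y → A t y) ys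

  count : ℕ → List X → ℕ
  count t [] = 0
  count t (y ∷ ys) with A? t y
  ... | yes _ = suc (count t ys)
  ... | no _  = count t ys

  count≤length : ∀ t ys → count t ys ≤ length ys
  count≤length t [] = z≤n
  count≤length t (y ∷ ys) with A? t y
  ... | yes _ = s≤s (count≤length t ys)
  ... | no _  = m≤n⇒m≤1+n (count≤length t ys)

  count-mono : ∀ t ys → count t ys ≤ count (suc t) ys
  count-mono t [] = z≤n
  count-mono t (y ∷ ys) with A? t y | A? (suc t) y
  ... | yes _  | yes _   = s≤s (count-mono t ys)
  ... | yes ty | no ¬t+1y = ⊥-elim (¬t+1y (A-suc ty))
  ... | no _   | yes _   = m≤n⇒m≤1+n (count-mono t ys)
  ... | no _   | no _    = count-mono t ys

  ¬settled⇒count< : ∀ t ys → ¬ Settled t ys → count t ys < count (suc t) ys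
  ¬settled⇒count< t [] ¬settled = ⊥-elim (¬settled [])
  ¬settled⇒count< t (y ∷ ys) ¬settled with A? t y | A? (suc t) y
  ... | yes ty | yes _    = s≤s (¬settled⇒count< t ys (λ settled → ¬settled ((λ _ → ty) ∷ settled)))
  ... | yes ty | no ¬t+1y = ⊥-elim (¬t+1y (A-suc ty))
  ... | no _   | yes _    = s≤s (count-mono t ys)
  ... | no _   | no ¬t+1y = ¬settled⇒count< t ys (λ settled → ¬settled ((λ t+1y → ⊥-elim (¬t+1y t+1y)) ∷ settled))

  length≤count⇒All : ∀ t ys → length ys ≤ count t ys → All (A t) ys
  length≤count⇒All t [] _ = []
  length≤count⇒All t (y ∷ ys) len≤ with A? t y
  ... | yes ty = ty ∷ length≤count⇒All t ys (≤-pred len≤)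
  ... | no _   = ⊥-elim (<⇒≱ (s≤s (count≤length t ys)) len≤)

  settled? : ∀ t ys → Dec (Settled t ys)
  settled? t [] = yes []
  settled? t (y ∷ ys) with A? t y | A? (suc t) y | settled? t ys
  ... | _      | _        | no ¬settled = no λ { (_ ∷ settled) → ¬settled settled }
  ... | yes ty | _        | yes settled = yes ((λ _ → ty) ∷ settled)
  ... | no _   | no ¬t+1y | yes settled = yes ((λ t+1y → ⊥-elim (¬t+1y t+1y)) ∷ settled)
  ... | no ¬ty | yes t+1y | yes _       = no λ { (down ∷ _) → ¬ty (down t+1y) }

  settled⊎t≤count : ∀ t → Settled t xs ⊎ t ≤ count t xs
  settled⊎t≤count zero = inj₂ z≤n
  settled⊎t≤count (suc t) with settled⊎t≤count t
  ... | inj₁ settled = inj₁ (settled-suc t settled)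
  ... | inj₂ t≤count with settled? t xs
  ...   | yes settled = inj₁ (settled-suc t settled)
  ...   | no ¬settled = inj₂ (≤-trans (s≤s t≤count) (¬settled⇒count< t xs ¬settled))

  settled-at-length : Settled (length xs) xs
  settled-at-length with settled⊎t≤count (length xs)
  ... | inj₁ settled = settled
  ... | inj₂ len≤count = All.map (λ y _ → y) (length≤count⇒All (length xs) xs len≤count)

-- Gluing Kripke models below a new root

module Glue (I : Set) (M : I → KripkeModel) (r : (i : I) → World (M i))
            (V₀ : ℕ → Set) (V₀⊆ : ∀ i w → _≼_ (M i) (r i) w → ∀ p → V₀ p → V (M i) w p) where

  private
    module M (i : I) = IsPartialOrder (isPO (M i))

  data Node : Set where
    root  : Node
    child : (i : I) → World (M i) → Node

  infix 4 _≤ᴳ_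
  data _≤ᴳ_ : Node → Node → Set where
    root≤root   : root ≤ᴳ root
    root≤child  : ∀ {i w} → _≼_ (M i) (r i) w → root ≤ᴳ child i w
    child≤child : ∀ {i w w′} → _≼_ (M i) w w′ → child i w ≤ᴳ child i w′

  root≤origin : ∀ i → root ≤ᴳ child i (r i)
  root≤origin i = root≤child (M.refl i)

  valuation : Node → ℕ → Set
  valuation root = V₀
  valuation (child i w) = V (M i) w

  ≤ᴳ-reflexive : ∀ {x y} → x ≡ y → x ≤ᴳ y
  ≤ᴳ-reflexive {root} refl = root≤root
  ≤ᴳ-reflexive {child i w} refl = child≤child (M.refl i)

  ≤ᴳ-trans : ∀ {x y z} → x ≤ᴳ y → y ≤ᴳ z → x ≤ᴳ z
  ≤ᴳ-trans root≤root y≤z = y≤z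
  ≤ᴳ-trans (root≤child {i} r≼w) (child≤child w≼w′) = root≤child (M.trans i r≼w w≼w′)
  ≤ᴳ-trans (child≤child {i} w≼w′) (child≤child w′≼w″) = child≤child (M.trans i w≼w′ w′≼w″)

  ≤ᴳ-antisym : ∀ {x y} → x ≤ᴳ y → y ≤ᴳ x → x ≡ y
  ≤ᴳ-antisym root≤root root≤root = refl
  ≤ᴳ-antisym (child≤child {i} w≼w′) (child≤child w′≼w) = cong (child i) (M.antisym i w≼w′ w′≼w)

  valuation-mono : ∀ {x y} → x ≤ᴳ y → ∀ p → valuation x p → valuation y p
  valuation-mono root≤root p = λ v → v
  valuation-mono (root≤child {i} {w} r≼w) = V₀⊆ i w r≼w
  valuation-mono (child≤child {i} w≼w′) = mono (M i) w≼w′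

  glued : KripkeModel
  glued = record
    { World = Node
    ; inhabit = root
    ; _≼_ = _≤ᴳ_
    ; isPO = record
      { isPreorder = record { isEquivalence = isEquivalence ; reflexive = ≤ᴳ-reflexive ; trans = ≤ᴳ-trans }
      ; antisym = ≤ᴳ-antisym }
    ; V = valuation
    ; mono = valuation-mono
    }

  mutual
    ⊩⇒child⊩ : ∀ i w δ → M i , w ⊩ δ → glued , child i w ⊩ δ
    ⊩⇒child⊩ i w (atom p) w⊩p = w⊩p
    ⊩⇒child⊩ i w (a ⇒ b) w⊩a⇒b (child .i w′) (child≤child w≼w′) w′⊩a =
      ⊩⇒child⊩ i w′ b (w⊩a⇒b w′ w≼w′ (child⊩⇒⊩ i w′ a w′⊩a))

    child⊩⇒⊩ : ∀ i w δ → glued , child i w ⊩ δ → M i , w ⊩ δ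
    child⊩⇒⊩ i w (atom p) w⊩p = w⊩p
    child⊩⇒⊩ i w (a ⇒ b) w⊩a⇒b w′ w≼w′ w′⊩a =
      child⊩⇒⊩ i w′ b (w⊩a⇒b (child i w′) (child≤child w≼w′) (⊩⇒child⊩ i w′ a w′⊩a))

degree≡1+connectives*2 : ∀ α → degree α ≡ suc (connectives α * 2)
degree≡1+connectives*2 (atom _) = refl
degree≡1+connectives*2 (a ⇒ b) =
  trans (cong suc (cong₂ _+_ (degree≡1+connectives*2 a) (degree≡1+connectives*2 b)))
        (regroup (connectives a) (connectives b))
  where
    regroup : ∀ x y → suc (suc (x * 2) + suc (y * 2)) ≡ suc (suc (x + y) * 2)
    regroup = solve-∀

2^[2+c*2]≡4^[1+c] : ∀ c → 2 ^ (suc (c * 2) + 1) ≡ 4 ^ suc c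
2^[2+c*2]≡4^[1+c] c = trans (cong (2 ^_) (exponent c)) (sym (^-*-assoc 2 2 (suc c)))
  where
    exponent : ∀ c → suc (c * 2) + 1 ≡ 2 * suc c
    exponent = solve-∀

[1+c]²≤4^c : ∀ c → suc c * suc c ≤ 4 ^ c
[1+c]²≤4^c zero = s≤s z≤n
[1+c]²≤4^c (suc c) = begin
  suc (suc c) * suc (suc c)                      ≤⟨ m≤m+n _ (c * c * 3 + c * 4) ⟩
  suc (suc c) * suc (suc c) + (c * c * 3 + c * 4) ≡⟨ expand c ⟩
  4 * (suc c * suc c)                            ≤⟨ *-monoʳ-≤ 4 ([1+c]²≤4^c c) ⟩
  4 * 4 ^ c                                      ∎
  where
    open ≤-Reasoning
    expand : ∀ c → suc (suc c) * suc (suc c) + (c * c * 3 + c * 4) ≡ 4 * (suc c * suc c)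
    expand = solve-∀

cubic≤exponential : ∀ c → suc c * (c * 2 + suc c * (c * 3 + 2)) ≤ suc (c * 2) * 2 ^ (suc (c * 2) + 1)
cubic≤exponential c = begin
  suc c * (c * 2 + suc c * (c * 3 + 2))                  ≤⟨ *-monoʳ-≤ (suc c) (m≤m+n _ (c * c + c + 2)) ⟩
  suc c * (c * 2 + suc c * (c * 3 + 2) + (c * c + c + 2)) ≡⟨ cong (suc c *_) (expand c) ⟩
  suc c * (4 * (suc c * suc c))                          ≤⟨ *-mono-≤ (s≤s (m≤m*n c 2)) (*-monoʳ-≤ 4 ([1+c]²≤4^c c)) ⟩
  suc (c * 2) * 4 ^ suc c                                ≡⟨ cong (suc (c * 2) *_) (sym (2^[2+c*2]≡4^[1+c] c)) ⟩
  suc (c * 2) * 2 ^ (suc (c * 2) + 1)                    ∎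
  where
    open ≤-Reasoning
    expand : ∀ c → c * 2 + suc c * (c * 3 + 2) + (c * c + c + 2) ≡ 4 * (suc c * suc c)
    expand = solve-∀

missing : List Formula → List Formula → ℕ
missing Γ [] = 0
missing Γ (a ∷ L) with a ∈? Γ
... | yes _ = missing Γ L
... | no _  = suc (missing Γ L)

missing≤length : ∀ Γ L → missing Γ L ≤ length L
missing≤length Γ [] = z≤n
missing≤length Γ (a ∷ L) with a ∈? Γ
... | yes _ = m≤n⇒m≤1+n (missing≤length Γ L)
... | no _  = s≤s (missing≤length Γ L)

-- Splitting on a ≟ c rather than on a ∈? c ∷ Γ lets the latter compute.
missing-∷ : ∀ c Γ L → missing (c ∷ Γ) L ≤ missing Γ L
missing-∷ c Γ [] = z≤n
missing-∷ c Γ (a ∷ L) with a ∈? Γ | a ≟ c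
... | yes _ | yes _  = missing-∷ c Γ L
... | yes _ | no _   = missing-∷ c Γ L
... | no _  | yes _  = m≤n⇒m≤1+n (missing-∷ c Γ L)
... | no _  | no _   = s≤s (missing-∷ c Γ L)

missing-∷-< : ∀ c Γ L → c ∈ L → c ∉ Γ → missing (c ∷ Γ) L < missing Γ L
missing-∷-< c Γ (a ∷ L) (here refl) c∉Γ with a ∈? Γ | a ≟ a
... | yes c∈Γ | _       = ⊥-elim (c∉Γ c∈Γ)
... | no _    | yes _   = s≤s (missing-∷ c Γ L)
... | no _    | no c≢c  = ⊥-elim (c≢c refl)
missing-∷-< c Γ (a ∷ L) (there c∈L) c∉Γ with a ∈? Γ | a ≟ c
... | yes _ | yes _ = missing-∷-< c Γ L c∈L c∉Γ
... | yes _ | no _  = missing-∷-< c Γ L c∈L c∉Γ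
... | no _  | yes _ = m≤n⇒m≤1+n (missing-∷-< c Γ L c∈L c∉Γ)
... | no _  | no _  = s≤s (missing-∷-< c Γ L c∈L c∉Γ)

-- Separating models

Fires : (Formula → Set) → ℕ → Formula → Set
Fires R p x = target x ≡ p × All R (premises x)

module Separation (α : Formula) where

  c₀ : ℕ
  c₀ = connectives α

  -- K bounds the height added by one saturation round, Q the height added
  -- by one level, which consists of T rounds.
  K : ℕ
  K = c₀ * 3 + 2

  T : ℕ
  T = length (atoms α)

  Q : ℕ
  Q = c₀ * 2 + T * K

  record Separator (h : ℕ) (Γ : List Formula) : Set₁ where
    field
      model    : KripkeModel
      origin   : World model
      origin⊩Γ : All (model , origin ⊩_) Γ
      decide   : ∀ δ → δ ⊑ α → Bounded h Γ δ ⊎ ¬ (model , origin ⊩ δ)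

  module Step (h : ℕ) (Γ : List Formula) (Γ⊑ : All (_⊑ α) Γ)
              (extend : ∀ c → c ∈ antecedents α → c ∉ Γ → Separator h (c ∷ Γ)) where

    data Reach : ℕ → Formula → Set where
      ⇒-assumed  : ∀ {t c d} → c ∈ Γ → Reach t d → Reach t (c ⇒ d)
      ⇒-extended : ∀ {t c d} → c ∉ Γ → Bounded h (c ∷ Γ) d → Reach t (c ⇒ d)
      fire       : ∀ {t u p} → u < t → Any (Fires (Reach u) p) Γ → Reach t (atom p)

    Reach-mono : ∀ {t t′ δ} → t ≤ t′ → Reach t δ → Reach t′ δ
    Reach-mono t≤t′ (⇒-assumed c∈Γ r) = ⇒-assumed c∈Γ (Reach-mono t≤t′ r)
    Reach-mono t≤t′ (⇒-extended c∉Γ ⊢d) = ⇒-extended c∉Γ ⊢d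
    Reach-mono t≤t′ (fire u<t f) = fire (≤-trans u<t t≤t′) f

    mutual
      reach? : ∀ t δ → δ ⊑ α → Dec (Reach t δ)
      reach? t (atom p) _ = reach-atom? t p
      reach? t (c ⇒ d) s with c ∈? Γ
      ... | yes c∈Γ = Dec.map′ (⇒-assumed c∈Γ) (λ { (⇒-assumed _ r) → r ; (⇒-extended c∉Γ _) → ⊥-elim (c∉Γ c∈Γ) })
                                (reach? t d (⇒-⊑ʳ s))
      ... | no c∉Γ with Separator.decide (extend c (antecedent∈ s) c∉Γ) d (⇒-⊑ʳ s)
      ...   | inj₁ ⊢d = yes (⇒-extended c∉Γ ⊢d)
      ...   | inj₂ ⊮d = no λ
        { (⇒-assumed c∈Γ _) → c∉Γ c∈Γ
        ; (⇒-extended _ (⊢d , _)) → ⊮d (soundness (Separator.model S) ⊢d _ (Separator.origin⊩Γ S)) }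
        where S = extend c (antecedent∈ s) c∉Γ

      reach-atom? : ∀ t p → Dec (Reach t (atom p))
      reach-atom? zero p = no λ { (fire () _) }
      reach-atom? (suc t) p = Dec.map′ (fire ≤-refl)
        (λ { (fire u<t+1 f) → Any.map (Product.map₂ (All.map (Reach-mono (≤-pred u<t+1)))) f })
        (fires? t p Γ Γ⊑)

      fires? : ∀ t p Δ → All (_⊑ α) Δ → Dec (Any (Fires (Reach t) p) Δ)
      fires? t p [] [] = no λ ()
      fires? t p (x ∷ Δ) (s ∷ ss) = Dec.map′ Any.fromSum Any.toSum
        ((target x ℕ.≟ p ×-dec all-reach? t (premises x) (premises-⊑ s)) ⊎-dec fires? t p Δ ss)

      all-reach? : ∀ t ys → All (_⊑ α) ys → Dec (All (Reach t) ys)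
      all-reach? t [] [] = yes []
      all-reach? t (y ∷ ys) (s ∷ ss) = Dec.map′ (Product.uncurry _∷_) All.uncons
        (reach? t y s ×-dec all-reach? t ys ss)

    reachBound : ℕ → Formula → ℕ
    reachBound t δ = length (premises δ) * 2 + t * K + h

    mutual
      reach⇒bounded : ∀ {t δ} → Reach t δ → Bounded (reachBound t δ) Γ δ
      reach⇒bounded (⇒-assumed _ r) with reach⇒bounded r
      ... | d , cf , d≤ = ⇒R (weak d) , ⇒R (weak cf) , s≤s (s≤s d≤)
      reach⇒bounded (⇒-extended _ (d , cf , d≤h)) =
        ⇒R d , ⇒R cf , s≤s (m≤n⇒m≤1+n (≤-trans d≤h (m≤n+m h _)))
      reach⇒bounded (fire u<t f) = fires⇒bounded u<t Γ⊑ (λ x∈ → x∈) f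

      fires⇒bounded : ∀ {t u p Δ} → u < t → All (_⊑ α) Δ → (∀ {x} → x ∈ Δ → x ∈ Γ)
                    → Any (Fires (Reach u) p) Δ → Bounded (reachBound t (atom p)) Γ (atom p)
      fires⇒bounded u<t (_ ∷ ss) Δ⊆Γ (there f) = fires⇒bounded u<t ss (λ x∈ → Δ⊆Γ (there x∈)) f
      fires⇒bounded {t} {u} {p} {x ∷ _} u<t (s ∷ _) Δ⊆Γ (here (refl , rs)) =
        Bounded-mono round (Bounded-target (Δ⊆Γ (here refl)) (all-reach⇒bounded (premises-⊑ s) rs))
        where
          cost : ∀ c x h → suc (c + suc (c * 2 + x + h)) ≡ c * 3 + 2 + x + h
          cost = solve-∀

          open ≤-Reasoning
          round : suc (length (premises x) + suc (c₀ * 2 + u * K + h)) ≤ t * K + h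
          round = begin
            suc (length (premises x) + suc (c₀ * 2 + u * K + h)) ≤⟨ s≤s (+-monoˡ-≤ _ (length-premises≤-⊑ s)) ⟩
            suc (c₀ + suc (c₀ * 2 + u * K + h))                  ≡⟨ cost c₀ (u * K) h ⟩
            suc u * K + h                                        ≤⟨ +-monoˡ-≤ h (*-monoˡ-≤ K u<t) ⟩
            t * K + h                                            ∎

      all-reach⇒bounded : ∀ {u ys} → All (_⊑ α) ys → All (Reach u) ys → All (Bounded (c₀ * 2 + u * K + h) Γ) ys
      all-reach⇒bounded [] [] = []
      all-reach⇒bounded (s ∷ ss) (r ∷ rs) =
        Bounded-mono (+-monoˡ-≤ h (+-monoˡ-≤ _ (*-monoˡ-≤ 2 (length-premises≤-⊑ s)))) (reach⇒bounded r)
        ∷ all-reach⇒bounded ss rs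

    Settled : ℕ → Set
    Settled t = All (λ p → Reach (suc t) (atom p) → Reach t (atom p)) (atoms α)

    lower : ∀ {t y} → Settled t → y ⊑ α → Reach (suc t) y → Reach t y
    lower {y = atom _} settled s r = All.lookup settled (target∈atoms α s) r
    lower settled s (⇒-assumed c∈Γ r) = ⇒-assumed c∈Γ (lower settled (⇒-⊑ʳ s) r)
    lower settled s (⇒-extended c∉Γ ⊢d) = ⇒-extended c∉Γ ⊢d

    lower-fires : ∀ {t u p Δ} → Settled t → u ≤ suc t → All (_⊑ α) Δ
                → Any (Fires (Reach u) p) Δ → Any (Fires (Reach t) p) Δ
    lower-fires settled u≤ (s ∷ _) (here (e , rs)) =
      here (e , All.zipWith (λ (s′ , r) → lower settled s′ r) (premises-⊑ s , All.map (Reach-mono u≤) rs))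
    lower-fires settled u≤ (_ ∷ ss) (there f) = there (lower-fires settled u≤ ss f)

    -- A round only consults the previous one, so once a round adds nothing, neither does the next.
    settled-suc : ∀ t → Settled t → Settled (suc t)
    settled-suc t settled = All.tabulate λ { _ (fire u<t+2 f) → fire ≤-refl (lower-fires settled (≤-pred u<t+2) Γ⊑ f) }

    open Stabilisation (λ t p → Reach t (atom p)) reach-atom? (Reach-mono (n≤1+n _)) (atoms α) settled-suc
      using (settled-at-length)

    reach-closed : ∀ {x} → x ∈ Γ → All (Reach T) (premises x) → Reach T (atom (target x))
    reach-closed {x} x∈Γ rs =
      All.lookup settled-at-length (target∈atoms α (All.lookup Γ⊑ x∈Γ)) (fire ≤-refl (lose x∈Γ (refl , rs)))

    Extension : Set
    Extension = Σ Formula λ c → c ∈ antecedents α × c ∉ Γ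

    separatorOf : (i : Extension) → Separator h (proj₁ i ∷ Γ)
    separatorOf (c , c∈ , c∉Γ) = extend c c∈ c∉Γ

    modelOf : Extension → KripkeModel
    modelOf i = Separator.model (separatorOf i)

    originOf : (i : Extension) → World (modelOf i)
    originOf i = Separator.origin (separatorOf i)

    above-origin⊩Γ : ∀ i w → _≼_ (modelOf i) (originOf i) w → All (modelOf i , w ⊩_) Γ
    above-origin⊩Γ i w o≼w with Separator.origin⊩Γ (separatorOf i)
    ... | _ ∷ o⊩Γ = All.map (λ {δ} → ⊩-mono (modelOf i) δ o≼w) o⊩Γ

    origin⊩c : ∀ i → modelOf i , originOf i ⊩ proj₁ i
    origin⊩c i with Separator.origin⊩Γ (separatorOf i)
    ... | o⊩c ∷ _ = o⊩c

    reach⊆above-origin : ∀ i w → _≼_ (modelOf i) (originOf i) w → ∀ p → Reach T (atom p) → V (modelOf i) w p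
    reach⊆above-origin i w o≼w p r = soundness (modelOf i) (proj₁ (reach⇒bounded r)) w (above-origin⊩Γ i w o≼w)

    open Glue Extension modelOf originOf (λ p → Reach T (atom p)) reach⊆above-origin

    child⊩Γ : ∀ i w → _≼_ (modelOf i) (originOf i) w → All (glued , child i w ⊩_) Γ
    child⊩Γ i w o≼w = All.map (λ {δ} → ⊩⇒child⊩ i w δ) (above-origin⊩Γ i w o≼w)

    -- The root forces exactly the reachable subformulas, and forces y for every assumption
    -- cs ⟶ y in Γ whose premises cs are reachable; the three facts are proved together.
    mutual
      ¬reach⇒root⊮ : ∀ δ → δ ⊑ α → ¬ Reach T δ → ¬ (glued , root ⊩ δ)
      ¬reach⇒root⊮ (atom p) _ ¬r root⊩p = ¬r root⊩p
      ¬reach⇒root⊮ (c ⇒ d) s ¬r root⊩c⇒d with c ∈? Γ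
      ... | yes c∈Γ = ¬reach⇒root⊮ d (⇒-⊑ʳ s) (¬r ∘ ⇒-assumed c∈Γ)
        (root⊩c⇒d root root≤root (root⊩-residue c∈Γ [] c (All.lookup Γ⊑ c∈Γ) refl []))
      ... | no c∉Γ with Separator.decide (extend c (antecedent∈ s) c∉Γ) d (⇒-⊑ʳ s)
      ...   | inj₁ ⊢d = ¬r (⇒-extended c∉Γ ⊢d)
      ...   | inj₂ ⊮d = ⊮d (child⊩⇒⊩ i o d (root⊩c⇒d (child i o) (root≤origin i) (⊩⇒child⊩ i o c (origin⊩c i))))
        where
          i = c , antecedent∈ s , c∉Γ
          o = originOf i

      root⊩⇒reach : ∀ δ → δ ⊑ α → glued , root ⊩ δ → Reach T δ
      root⊩⇒reach δ s root⊩δ with reach? T δ s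
      ... | yes r = r
      ... | no ¬r = ⊥-elim (¬reach⇒root⊮ δ s ¬r root⊩δ)

      root⊩-residue : ∀ {x} → x ∈ Γ → ∀ cs y → y ⊑ α → x ≡ cs ⟶ y → All (Reach T) cs → glued , root ⊩ y
      root⊩-residue {x} x∈Γ cs (atom p) _ refl rs =
        subst (λ q → Reach T (atom q)) (target-⟶ cs p)
          (reach-closed x∈Γ (subst (All (Reach T)) (sym (premises-⟶ cs p)) rs))
      root⊩-residue {x} x∈Γ cs (c ⇒ d) s x≡ rs = root⊩c⇒d
        where
          root⊩c⇒d : ∀ j → root ≤ᴳ j → glued , j ⊩ c → glued , j ⊩ d
          root⊩c⇒d root root≤root root⊩c =
            root⊩-residue x∈Γ (cs ∷ʳ c) d (⇒-⊑ʳ s) (trans x≡ (⟶-∷ʳ cs c d)) (∷ʳ⁺ rs (root⊩⇒reach c (⇒-⊑ˡ s) root⊩c))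
          root⊩c⇒d (child i w) (root≤child o≼w) w⊩c =
            ⊩-⟶-elim glued (child i w) cs (c ⇒ d) (subst (glued , child i w ⊩_) x≡ (All.lookup Γ-forced x∈Γ))
              (All.map (λ r → soundness glued (proj₁ (reach⇒bounded r)) (child i w) Γ-forced) rs)
              (child i w) (≤ᴳ-reflexive refl) w⊩c
            where
              Γ-forced = child⊩Γ i w o≼w

    root⊩Γ : All (glued , root ⊩_) Γ
    root⊩Γ = All.tabulate λ {x} x∈Γ → root⊩-residue x∈Γ [] x (All.lookup Γ⊑ x∈Γ) refl []

    separator : Separator (Q + h) Γ
    separator = record
      { model = glued
      ; origin = root
      ; origin⊩Γ = root⊩Γ
      ; decide = decide }
      where
        decide : ∀ δ → δ ⊑ α → Bounded (Q + h) Γ δ ⊎ ¬ (glued , root ⊩ δ)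
        decide δ s with reach? T δ s
        ... | yes r = inj₁ (Bounded-mono (+-monoˡ-≤ h (+-monoˡ-≤ (T * K) (*-monoˡ-≤ 2 (length-premises≤-⊑ s))))
                                         (reach⇒bounded r))
        ... | no ¬r = inj₂ (¬reach⇒root⊮ δ s ¬r)

  separator-with-missing≤ : ∀ k Γ → All (_⊑ α) Γ → missing Γ (antecedents α) ≤ k → Separator (suc k * Q) Γ
  separator-with-missing≤ zero Γ Γ⊑ missing≤0 = Step.separator 0 Γ Γ⊑ λ c c∈ c∉Γ →
    ⊥-elim (<⇒≱ (≤-trans (missing-∷-< c Γ (antecedents α) c∈ c∉Γ) missing≤0) z≤n)
  separator-with-missing≤ (suc k) Γ Γ⊑ missing≤ = Step.separator (suc k * Q) Γ Γ⊑ λ c c∈ c∉Γ →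
    separator-with-missing≤ k (c ∷ Γ) (∈antecedents⇒⊑ α c∈ ∷ Γ⊑)
      (≤-pred (≤-trans (missing-∷-< c Γ (antecedents α) c∈ c∉Γ) missing≤))

  empty-separator : Separator (suc c₀ * Q) []
  empty-separator = separator-with-missing≤ c₀ [] []
    (subst (missing [] (antecedents α) ≤_) (length-antecedents α) (missing≤length [] (antecedents α)))

  suc-c₀*Q≤degree*2^[degree+1] : suc c₀ * Q ≤ degree α * 2 ^ (degree α + 1)
  suc-c₀*Q≤degree*2^[degree+1] rewrite length-atoms α | degree≡1+connectives*2 α = cubic≤exponential c₀

theorem1 : (α : Formula) → Tautology α
    → Σ ([] ⊢ α) (λ d → CutFree d × height d ≤ degree α * 2 ^ (degree α + 1))
theorem1 α taut with Separation.Separator.decide (Separation.empty-separator α) α here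
... | inj₁ (d , cf , d≤) = d , cf , ≤-trans d≤ (Separation.suc-c₀*Q≤degree*2^[degree+1] α)
... | inj₂ ⊮α = ⊥-elim (⊮α (taut _ _))
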